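{- Let $n\ge 3$ and let $W_n$ be the wheel. Then $W_n$ is a square if $n$ is even and is not a square if $n$ is odd. Further, the square root of $W_n$ is unique up to isomorphism: if $H_1,H_2$ are partially labeled graphs with $H_1H_1\cong W_n\cong H_2H_2$, then $H_1\cong H_2$.
   Context: The wheel $W_n$ is the cycle $C_n$ together with one additional vertex adjacent to every vertex of the cycle. All graphs are finite and simple. A partially labeled graph is a graph $H$ together with an injective map $\theta: L\to V(H)$, $L\subseteq\mathbb{N}$, whose image $\theta(L)$ is nonempty and a proper subset of $V(H)$; vertices in $\theta(L)$ are labeled. The square $HH$ is obtained from two disjoint copies of $H$ by identifying each labeled vertex $\theta(\ell)$ of the first copy with $\theta(\ell)$ of the second copy (keeping all edges, merging double edges). A graph $G$ is a square if $G\cong HH$ for some partially labeled graph $H$, called a square root of $G$. -}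

module Defs where

open import Data.Nat using (ℕ; zero; suc; _<_; _≡ᵇ_)
open import Data.Fin using (Fin; toℕ; _≟_)
import Data.Fin as F
open import Data.Bool using (Bool; true; false; _∨_; if_then_else_)
open import Data.Sum using (_⊎_; inj₁; inj₂)
open import Data.Product using (Σ; ∃; _×_; _,_)
open import Relation.Nullary.Decidable using (⌊_⌋)
open import Relation.Binary.PropositionalEquality using (_≡_; _≢_)
open import Function.Bundles using (_↔_; Inverse)
open import Function.Definitions using (Injective)
import Data.Fin.Properties as FP

record SGraph : Set₁ where
  field
    V   : Set
    adj : V → V → Bool
open SGraph public

record _≅_ (G H : SGraph) : Set where
  field
    bij  : V G ↔ V H
    pres : ∀ u v → adj G u v ≡ adj H (Inverse.to bij u) (Inverse.to bij v)

record Graph (n : ℕ) : Set where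
  field
    adjG    : Fin n → Fin n → Bool
    sym     : ∀ u v → adjG u v ≡ adjG v u
    irrefl  : ∀ v → adjG v v ≡ false
open Graph public

toSG : ∀ {n} → Graph n → SGraph
toSG {n} G = record { V = Fin n ; adj = adjG G }

-- Partially labeled graph.  The label set L ⊆ ℕ is finite (θ is injective
-- into a finite set); we enumerate it as the image of an injective
-- map  lab : Fin k → ℕ, and θ(lab i) is written  θ i.
record PLGraph (n : ℕ) : Set where
  field
    graph   : Graph n
    k       : ℕ
    lab     : Fin k → ℕ
    lab-inj : Injective _≡_ _≡_ lab
    θ       : Fin k → Fin n
    θ-inj   : Injective _≡_ _≡_ θ
    nonempty : 0 < k
    proper  : ∃ λ (v : Fin n) → ∀ i → θ i ≢ v
open PLGraph public

labeled : ∀ {n} → PLGraph n → Fin n → Bool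
labeled H v = ⌊ FP.any? (λ i → θ H i ≟ v) ⌋

-- The square HH: vertices are the vertices of the first copy (labeled
-- vertices being the identified ones) together with the unlabeled
-- vertices of the second copy.
sqV : ∀ {n} → PLGraph n → Set
sqV {n} H = Fin n ⊎ Σ (Fin n) (λ v → labeled H v ≡ false)

sqAdj : ∀ {n} (H : PLGraph n) → sqV H → sqV H → Bool
sqAdj H (inj₁ u)       (inj₁ v)       = adjG (graph H) u v
sqAdj H (inj₂ (u , _)) (inj₂ (v , _)) = adjG (graph H) u v
sqAdj H (inj₁ u)       (inj₂ (v , _)) = if labeled H u then adjG (graph H) u v else false
sqAdj H (inj₂ (u , _)) (inj₁ v)       = if labeled H v then adjG (graph H) u v else false

square : ∀ {n} → PLGraph n → SGraph
square H = record { V = sqV H ; adj = sqAdj H }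

IsSquare : SGraph → Set
IsSquare G = Σ ℕ λ m → Σ (PLGraph m) λ H → square H ≅ G

record _≅PL_ {m₁ m₂} (H₁ : PLGraph m₁) (H₂ : PLGraph m₂) : Set where
  field
    iso     : toSG (graph H₁) ≅ toSG (graph H₂)
    labels  : ∀ v → labeled H₁ v ≡ labeled H₂ (Inverse.to (_≅_.bij iso) v)

-- The wheel W_n: vertex F.zero is the hub, vertices F.suc i (i : Fin n)
-- form the cycle C_n with i ~ i+1 (mod n).
nextℕ : ℕ → ℕ → ℕ
nextℕ n i = if suc i ≡ᵇ n then 0 else suc i

cycAdj : ∀ n → Fin n → Fin n → Bool
cycAdj n i j = (toℕ j ≡ᵇ nextℕ n (toℕ i)) ∨ (toℕ i ≡ᵇ nextℕ n (toℕ j))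

wheelAdj : ∀ n → Fin (suc n) → Fin (suc n) → Bool
wheelAdj n F.zero    F.zero    = false
wheelAdj n F.zero    (F.suc j) = true
wheelAdj n (F.suc i) F.zero    = true
wheelAdj n (F.suc i) (F.suc j) = cycAdj n i j

wheel : ℕ → SGraph
wheel n = record { V = Fin (suc n) ; adj = wheelAdj n }

{-# OPTIONS --safe #-}

-- The swap σ of the two copies of H is an involutive automorphism of HH fixing exactly the
-- labelled vertices, and no edge joins unlabelled vertices of different copies.  Transported
-- to W_n, σ fixes the hub (it is adjacent to every other vertex), so it restricts to an
-- involutive automorphism of the rim C_n.  Walking along the rim from an unlabelled vertex to
-- its image one meets a fixed vertex a.  An automorphism of C_n is determined by the images of
-- two consecutive vertices, and σ cannot fix a + 1 (it would be the identity), so σ is the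
-- reflection through a.  Walking on from a + 1 to σ(a + 1) = a - 1 one meets a second fixed
-- vertex a + m, and being fixed by the reflection forces n = 2m.  Folding W_n along this axis
-- identifies H with the fan: a hub joined to a path 0, …, m, labelled at the hub and at both
-- ends.  Conversely this fan squares to W_2m.

module Submission where

open import Defs hiding (sym)
open import Data.Nat.Divisibility using (_∣_; divides)
open import Data.Nat using (ℕ; zero; suc; _+_; _*_; _∸_; _⊓_; _≤_; _<_; _≡ᵇ_; _≤?_; z≤n; s≤s; s≤s⁻¹; z<s)
open import Data.Nat.Properties
open import Data.Nat.DivMod using (_%_; _/_; m%n<n; m≡m%n+[m/n]*n)
open import Data.Fin using (Fin; toℕ; fromℕ<)
import Data.Fin as F
import Data.Fin.Properties as FP
open import Data.Bool using (Bool; true; false; _∨_; T; if_then_else_)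
open import Data.Bool.Properties using (∨-comm; ¬-not) renaming (_≟_ to _≟ᴮ_)
open import Axiom.UniquenessOfIdentityProofs using (module Decidable⇒UIP)
open import Data.Sum using (_⊎_; inj₁; inj₂)
import Data.Sum as Sum
open import Data.Product using (Σ; ∃; _×_; _,_; proj₁; proj₂)
open import Relation.Nullary using (¬_; Dec; yes; no; does)
open import Relation.Nullary.Decidable using (dec-true; dec-false; does-⇔; _⊎-dec_; isYes≗does)
open import Function.Bundles using (_⇔_; mk⇔; Inverse; mk↔ₛ′)
open import Function.Properties.Inverse using (↔-sym; ↔-trans)
open import Relation.Binary.PropositionalEquality
open import Relation.Binary.Definitions using (DecidableEquality)
open import Function.Base using (case_of_; _∘_)
open import Data.Empty using (⊥; ⊥-elim)

witness : ∀ {A : Set} (d : Dec A) → does d ≡ true → A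
witness (yes a) _ = a

-- Rotations, reflections and automorphisms of the cycle

module _ {n′ : ℕ} where
  private
    n : ℕ
    n = suc n′

  nextℕ<n : ∀ i → i < n → nextℕ n i < n
  nextℕ<n i i<n with suc i ≡ᵇ n in eq
  ... | true  = s≤s z≤n
  ... | false = ≤∧≢⇒< i<n (λ si≡n → subst T eq (≡⇒≡ᵇ _ _ si≡n))

  nextℕ-suc : ∀ i → suc i < n → nextℕ n i ≡ suc i
  nextℕ-suc i si<n with suc i ≡ᵇ n in eq
  ... | true  = ⊥-elim (<-irrefl (≡ᵇ⇒≡ _ _ (subst T (sym eq) _)) si<n)
  ... | false = refl

  nextℕ-last : nextℕ n n′ ≡ 0
  nextℕ-last with suc n′ ≡ᵇ n | ≡⇒≡ᵇ n n refl
  ... | true | _ = refl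

  next : Fin n → Fin n
  next x = fromℕ< (nextℕ<n (toℕ x) (FP.toℕ<n x))

  toℕ-next : ∀ x → toℕ (next x) ≡ nextℕ n (toℕ x)
  toℕ-next x = FP.toℕ-fromℕ< _

  rotate : ℕ → Fin n → Fin n
  rotate zero    x = x
  rotate (suc l) x = next (rotate l x)

  rotate-+ : ∀ a b x → rotate (a + b) x ≡ rotate a (rotate b x)
  rotate-+ zero    b x = refl
  rotate-+ (suc a) b x = cong next (rotate-+ a b x)

  rotate-comm : ∀ a b x → rotate a (rotate b x) ≡ rotate b (rotate a x)
  rotate-comm a b x = begin
    rotate a (rotate b x) ≡⟨ rotate-+ a b x ⟨
    rotate (a + b) x      ≡⟨ cong (λ l → rotate l x) (+-comm a b) ⟩
    rotate (b + a) x      ≡⟨ rotate-+ b a x ⟩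
    rotate b (rotate a x) ∎
    where open ≡-Reasoning

  toℕ-rotate-zero : ∀ l → l < n → toℕ (rotate l F.zero) ≡ l
  toℕ-rotate-zero zero    _    = refl
  toℕ-rotate-zero (suc l) l<n = begin
    toℕ (next (rotate l F.zero))    ≡⟨ toℕ-next (rotate l F.zero) ⟩
    nextℕ n (toℕ (rotate l F.zero)) ≡⟨ cong (nextℕ n) (toℕ-rotate-zero l (<-trans (n<1+n l) l<n)) ⟩
    nextℕ n l                       ≡⟨ nextℕ-suc l l<n ⟩
    suc l                           ∎
    where open ≡-Reasoning

  rotate-toℕ : ∀ y → rotate (toℕ y) F.zero ≡ y
  rotate-toℕ y = FP.toℕ-injective (toℕ-rotate-zero (toℕ y) (FP.toℕ<n y))

  rotate-n-zero : rotate n F.zero ≡ F.zero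
  rotate-n-zero = FP.toℕ-injective (begin
    toℕ (next (rotate n′ F.zero))    ≡⟨ toℕ-next (rotate n′ F.zero) ⟩
    nextℕ n (toℕ (rotate n′ F.zero)) ≡⟨ cong (nextℕ n) (toℕ-rotate-zero n′ ≤-refl) ⟩
    nextℕ n n′                       ≡⟨ nextℕ-last ⟩
    0                                ∎)
    where open ≡-Reasoning

  rotate-n : ∀ x → rotate n x ≡ x
  rotate-n x = begin
    rotate n x                            ≡⟨ cong (rotate n) (rotate-toℕ x) ⟨
    rotate n (rotate (toℕ x) F.zero)      ≡⟨ rotate-comm n (toℕ x) F.zero ⟩
    rotate (toℕ x) (rotate n F.zero)      ≡⟨ cong (rotate (toℕ x)) rotate-n-zero ⟩
    rotate (toℕ x) F.zero                 ≡⟨ rotate-toℕ x ⟩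
    x                                     ∎
    where open ≡-Reasoning

  rotate-*n : ∀ q x → rotate (q * n) x ≡ x
  rotate-*n zero    x = refl
  rotate-*n (suc q) x = trans (rotate-+ n (q * n) x) (trans (rotate-n _) (rotate-*n q x))

  rotate-% : ∀ k x → rotate (k % n) x ≡ rotate k x
  rotate-% k x = begin
    rotate (k % n) x                       ≡⟨ cong (rotate (k % n)) (rotate-*n (k / n) x) ⟨
    rotate (k % n) (rotate (k / n * n) x)  ≡⟨ rotate-+ (k % n) (k / n * n) x ⟨
    rotate (k % n + k / n * n) x           ≡⟨ cong (λ l → rotate l x) (m≡m%n+[m/n]*n k n) ⟨
    rotate k x                             ∎
    where open ≡-Reasoning

  rotate-to-zero : ∀ x → rotate (n ∸ toℕ x) x ≡ F.zero
  rotate-to-zero x = begin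
    rotate (n ∸ i) x                  ≡⟨ cong (rotate (n ∸ i)) (rotate-toℕ x) ⟨
    rotate (n ∸ i) (rotate i F.zero)  ≡⟨ rotate-+ (n ∸ i) i F.zero ⟨
    rotate (n ∸ i + i) F.zero         ≡⟨ cong (λ l → rotate l F.zero) (m∸n+n≡m (<⇒≤ (FP.toℕ<n x))) ⟩
    rotate n F.zero                   ≡⟨ rotate-n-zero ⟩
    F.zero                            ∎
    where
      open ≡-Reasoning
      i = toℕ x

  rotate-injectiveˡ : ∀ {l l′} x → l < n → l′ < n → rotate l x ≡ rotate l′ x → l ≡ l′
  rotate-injectiveˡ {l} {l′} x l<n l′<n eq = begin
    l                                         ≡⟨ toℕ-rotate-zero l l<n ⟨
    toℕ (rotate l F.zero)                     ≡⟨ cong (λ z → toℕ (rotate l z)) (rotate-to-zero x) ⟨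
    toℕ (rotate l (rotate (n ∸ toℕ x) x))     ≡⟨ cong toℕ (rotate-comm l (n ∸ toℕ x) x) ⟩
    toℕ (rotate (n ∸ toℕ x) (rotate l x))     ≡⟨ cong (λ z → toℕ (rotate (n ∸ toℕ x) z)) eq ⟩
    toℕ (rotate (n ∸ toℕ x) (rotate l′ x))    ≡⟨ cong toℕ (rotate-comm (n ∸ toℕ x) l′ x) ⟩
    toℕ (rotate l′ (rotate (n ∸ toℕ x) x))    ≡⟨ cong (λ z → toℕ (rotate l′ z)) (rotate-to-zero x) ⟩
    toℕ (rotate l′ F.zero)                    ≡⟨ toℕ-rotate-zero l′ l′<n ⟩
    l′                                        ∎
    where open ≡-Reasoning

  next-injective : ∀ {x y} → next x ≡ next y → x ≡ y
  next-injective {x} {y} eq = begin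
    x                  ≡⟨ rotate-n x ⟨
    rotate n x         ≡⟨ rotate-comm 1 n′ x ⟩
    rotate n′ (next x) ≡⟨ cong (rotate n′) eq ⟩
    rotate n′ (next y) ≡⟨ rotate-comm 1 n′ y ⟨
    rotate n y         ≡⟨ rotate-n y ⟩
    y                  ∎
    where open ≡-Reasoning

  rotate-surjective : ∀ x y → ∃ λ l → l < n × rotate l x ≡ y
  rotate-surjective x y = steps % n , m%n<n steps n , (begin
    rotate (steps % n) x                     ≡⟨ rotate-% steps x ⟩
    rotate (toℕ y + (n ∸ toℕ x)) x           ≡⟨ rotate-+ (toℕ y) (n ∸ toℕ x) x ⟩
    rotate (toℕ y) (rotate (n ∸ toℕ x) x)    ≡⟨ cong (rotate (toℕ y)) (rotate-to-zero x) ⟩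
    rotate (toℕ y) F.zero                    ≡⟨ rotate-toℕ y ⟩
    y                                        ∎)
    where
      open ≡-Reasoning
      steps = toℕ y + (n ∸ toℕ x)

  position : Fin n → Fin n → ℕ
  position a y = proj₁ (rotate-surjective a y)

  position<n : ∀ a y → position a y < n
  position<n a y = proj₁ (proj₂ (rotate-surjective a y))

  rotate-position : ∀ a y → rotate (position a y) a ≡ y
  rotate-position a y = proj₂ (proj₂ (rotate-surjective a y))

  position-rotate : ∀ a {l} → l < n → position a (rotate l a) ≡ l
  position-rotate a {l} l<n = rotate-injectiveˡ a (position<n a (rotate l a)) l<n (rotate-position a (rotate l a))

  Adjacent : Fin n → Fin n → Set
  Adjacent x y = y ≡ next x ⊎ x ≡ next y

  adjacent? : ∀ x y → Dec (Adjacent x y)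
  adjacent? x y = (y F.≟ next x) ⊎-dec (x F.≟ next y)

  cycAdj≡adjacent? : ∀ x y → cycAdj n x y ≡ does (adjacent? x y)
  cycAdj≡adjacent? x y =
    cong₂ _∨_ (does-⇔ (next-spec x y) (toℕ y ≟ nextℕ n (toℕ x)) (y F.≟ next x))
              (does-⇔ (next-spec y x) (toℕ x ≟ nextℕ n (toℕ y)) (x F.≟ next y))
    where
      next-spec : ∀ x y → (toℕ y ≡ nextℕ n (toℕ x)) ⇔ (y ≡ next x)
      next-spec x y = mk⇔ (λ e → FP.toℕ-injective (trans e (sym (toℕ-next x))))
                          (λ e → trans (cong toℕ e) (toℕ-next x))

  cycAdj-true⇒adjacent : ∀ {x y} → cycAdj n x y ≡ true → Adjacent x y
  cycAdj-true⇒adjacent {x} {y} p = witness (adjacent? x y) (trans (sym (cycAdj≡adjacent? x y)) p)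

  adjacent⇒cycAdj-true : ∀ {x y} → Adjacent x y → cycAdj n x y ≡ true
  adjacent⇒cycAdj-true {x} {y} xy = trans (cycAdj≡adjacent? x y) (dec-true (adjacent? x y) xy)

  cycAdj-next : ∀ x → cycAdj n x (next x) ≡ true
  cycAdj-next x = adjacent⇒cycAdj-true {x} {next x} (inj₁ refl)

  cycAdj-sym : ∀ x y → cycAdj n x y ≡ cycAdj n y x
  cycAdj-sym x y = ∨-comm (toℕ y ≡ᵇ nextℕ n (toℕ x)) (toℕ x ≡ᵇ nextℕ n (toℕ y))

  ¬adjacent⇒cycAdj-false : ∀ {x y} → ¬ Adjacent x y → cycAdj n x y ≡ false
  ¬adjacent⇒cycAdj-false {x} {y} ¬xy = trans (cycAdj≡adjacent? x y) (dec-false (adjacent? x y) ¬xy)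

  cycAdj-cong : ∀ {x y x′ y′} → Adjacent x y ⇔ Adjacent x′ y′ → cycAdj n x y ≡ cycAdj n x′ y′
  cycAdj-cong {x} {y} {x′} {y′} xy⇔x′y′ = begin
    cycAdj n x y              ≡⟨ cycAdj≡adjacent? x y ⟩
    does (adjacent? x y)      ≡⟨ does-⇔ xy⇔x′y′ (adjacent? x y) (adjacent? x′ y′) ⟩
    does (adjacent? x′ y′)    ≡⟨ cycAdj≡adjacent? x′ y′ ⟨
    cycAdj n x′ y′            ∎
    where open ≡-Reasoning

  cycAdj-rotate : ∀ a i j → suc i < n → suc j < n →
                  cycAdj n (rotate i a) (rotate j a) ≡ does ((j ≟ suc i) ⊎-dec (i ≟ suc j))
  cycAdj-rotate a i j si<n sj<n =
    trans (cycAdj≡adjacent? (rotate i a) (rotate j a))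
          (does-⇔ (mk⇔ to from) (adjacent? (rotate i a) (rotate j a)) ((j ≟ suc i) ⊎-dec (i ≟ suc j)))
    where
      to : Adjacent (rotate i a) (rotate j a) → j ≡ suc i ⊎ i ≡ suc j
      to (inj₁ e) = inj₁ (rotate-injectiveˡ a (<-trans (n<1+n j) sj<n) si<n e)
      to (inj₂ e) = inj₂ (rotate-injectiveˡ a (<-trans (n<1+n i) si<n) sj<n e)
      from : j ≡ suc i ⊎ i ≡ suc j → Adjacent (rotate i a) (rotate j a)
      from (inj₁ refl) = inj₁ refl
      from (inj₂ refl) = inj₂ refl

  ReflectsAt : (Fin n → Fin n) → Fin n → Set
  ReflectsAt t a = ∀ j → j ≤ n → t (rotate j a) ≡ rotate (n ∸ j) a

  module _ {t : Fin n → Fin n} {a : Fin n} (t-reflects : ReflectsAt t a) where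

    reflection-involutive : ∀ x → t (t x) ≡ x
    reflection-involutive x with rotate-surjective a x
    ... | j , j<n , refl = begin
      t (t (rotate j a))         ≡⟨ cong t (t-reflects j (<⇒≤ j<n)) ⟩
      t (rotate (n ∸ j) a)       ≡⟨ t-reflects (n ∸ j) (m∸n≤m n j) ⟩
      rotate (n ∸ (n ∸ j)) a     ≡⟨ cong (λ l → rotate l a) (m∸[m∸n]≡n (<⇒≤ j<n)) ⟩
      rotate j a                 ∎
      where open ≡-Reasoning

    reflection-next : ∀ x → next (t (next x)) ≡ t x
    reflection-next x with rotate-surjective a x
    ... | j , j<n , refl = begin
      next (t (rotate (suc j) a))   ≡⟨ cong next (t-reflects (suc j) j<n) ⟩
      rotate (suc (n ∸ suc j)) a    ≡⟨ cong (λ l → rotate l a) (+-∸-assoc 1 j<n) ⟨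
      rotate (n ∸ j) a              ≡⟨ t-reflects j (<⇒≤ j<n) ⟨
      t (rotate j a)                ∎
      where open ≡-Reasoning

    reflection-injective : ∀ {x y} → t x ≡ t y → x ≡ y
    reflection-injective {x} {y} e =
      trans (sym (reflection-involutive x)) (trans (cong t e) (reflection-involutive y))

    reflection-adj : ∀ x y → cycAdj n (t x) (t y) ≡ cycAdj n x y
    reflection-adj x y = cycAdj-cong (mk⇔ to from)
      where
        to : Adjacent (t x) (t y) → Adjacent x y
        to (inj₁ e) = inj₂ (sym (reflection-injective (next-injective (trans (reflection-next y) e))))
        to (inj₂ e) = inj₁ (sym (reflection-injective (next-injective (trans (reflection-next x) e))))
        from : Adjacent x y → Adjacent (t x) (t y)
        from (inj₁ refl) = inj₂ (sym (reflection-next x))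
        from (inj₂ refl) = inj₁ (sym (reflection-next y))

  reflectionAt : Fin n → Fin n → Fin n
  reflectionAt a y = rotate (n ∸ position a y) a

  reflectionAt-reflects : ∀ a → ReflectsAt (reflectionAt a) a
  reflectionAt-reflects a j j≤n with m≤n⇒m<n∨m≡n j≤n
  ... | inj₁ j<n  = cong (λ l → rotate (n ∸ l) a) (position-rotate a j<n)
  ... | inj₂ refl = begin
    rotate (n ∸ position a (rotate n a)) a ≡⟨ cong (λ y → rotate (n ∸ position a y) a) (rotate-n a) ⟩
    rotate (n ∸ position a a) a            ≡⟨ cong (λ l → rotate (n ∸ l) a) (position-rotate a z<s) ⟩
    rotate n a                             ≡⟨ rotate-n a ⟩
    a                                      ≡⟨ cong (λ l → rotate l a) (n∸n≡0 n) ⟨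
    rotate (n ∸ n) a                       ∎
    where open ≡-Reasoning

  adjacent-unique : ∀ {v p q r} → Adjacent v p → Adjacent v q → Adjacent v r → r ≢ p → r ≢ q → p ≡ q
  adjacent-unique (inj₁ p≡) (inj₁ q≡) _         _   _   = trans p≡ (sym q≡)
  adjacent-unique (inj₂ ≡p) (inj₂ ≡q) _         _   _   = next-injective (trans (sym ≡p) ≡q)
  adjacent-unique (inj₁ p≡) (inj₂ ≡q) (inj₁ r≡) r≢p _   = ⊥-elim (r≢p (trans r≡ (sym p≡)))
  adjacent-unique (inj₁ p≡) (inj₂ ≡q) (inj₂ ≡r) _   r≢q = ⊥-elim (r≢q (next-injective (trans (sym ≡r) ≡q)))
  adjacent-unique (inj₂ ≡p) (inj₁ q≡) (inj₁ r≡) _   r≢q = ⊥-elim (r≢q (trans r≡ (sym q≡)))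
  adjacent-unique (inj₂ ≡p) (inj₁ q≡) (inj₂ ≡r) r≢p _   = ⊥-elim (r≢p (next-injective (trans (sym ≡r) ≡p)))

  record IsCycleAutomorphism (f : Fin n → Fin n) : Set where
    field
      preserves : ∀ x y → cycAdj n (f x) (f y) ≡ cycAdj n x y
      injective : ∀ {x y} → f x ≡ f y → x ≡ y

    adjacent-images : ∀ {x y} → cycAdj n x y ≡ true → Adjacent (f x) (f y)
    adjacent-images {x} {y} xy = cycAdj-true⇒adjacent (trans (preserves x y) xy)

  reflection-isAutomorphism : ∀ {t a} → ReflectsAt t a → IsCycleAutomorphism t
  reflection-isAutomorphism {t} {a} t-reflects = record
    { preserves = reflection-adj {t} {a} t-reflects
    ; injective = reflection-injective {t} {a} t-reflects
    }

  id-isAutomorphism : IsCycleAutomorphism (λ x → x)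
  id-isAutomorphism = record { preserves = λ _ _ → refl ; injective = λ e → e }

  module _ (2<n : 2 < n) where

    next-next≢ : ∀ x → next (next x) ≢ x
    next-next≢ x e = case rotate-injectiveˡ x 2<n (s≤s z≤n) e of λ ()

    automorphisms-agree : ∀ {f g} → IsCycleAutomorphism f → IsCycleAutomorphism g → ∀ a →
                          f a ≡ g a → f (next a) ≡ g (next a) → ∀ x → f x ≡ g x
    automorphisms-agree {f} {g} f-aut g-aut a fa fna x =
      subst (λ y → f y ≡ g y) (rotate-position a x) (proj₁ (agree (position a x)))
      where
        module Aᶠ = IsCycleAutomorphism f-aut
        module Aᵍ = IsCycleAutomorphism g-aut
        step : ∀ x → f x ≡ g x → f (next x) ≡ g (next x) → f (next (next x)) ≡ g (next (next x))
        step x e₀ e₁ = adjacent-unique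
          (Aᶠ.adjacent-images (cycAdj-next (next x)))
          (subst (λ v → Adjacent v (g (next (next x)))) (sym e₁) (Aᵍ.adjacent-images (cycAdj-next (next x))))
          (Aᶠ.adjacent-images (trans (cycAdj-sym (next x) x) (cycAdj-next x)))
          (λ e → next-next≢ x (sym (Aᶠ.injective e)))
          (λ e → next-next≢ x (sym (Aᵍ.injective (trans (sym e₀) e))))
        agree : ∀ j → f (rotate j a) ≡ g (rotate j a) × f (rotate (suc j) a) ≡ g (rotate (suc j) a)
        agree zero    = fa , fna
        agree (suc j) = proj₂ (agree j) , step (rotate j a) (proj₁ (agree j)) (proj₂ (agree j))

-- Square structures

data Part : Set where
  shared first second : Part

opposite : Part → Part
opposite shared = shared
opposite first  = second
opposite second = first

isShared : Part → Bool
isShared shared = true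
isShared first  = false
isShared second = false

self-opposite : ∀ {p} → p ≡ opposite p → p ≡ shared
self-opposite {shared} _ = refl

isShared-≢ : ∀ {p} → p ≢ shared → isShared p ≡ false
isShared-≢ {shared} p≢shared = ⊥-elim (p≢shared refl)
isShared-≢ {first}  _ = refl
isShared-≢ {second} _ = refl

OnSide : Part → Part → Set
OnSide side p = p ≡ shared ⊎ p ≡ side

opposite-sides : ∀ {side} → OnSide side first → OnSide side second → ⊥
opposite-sides (inj₂ refl) (inj₂ ())

shared? : ∀ p → Dec (p ≡ shared)
shared? shared = yes refl
shared? first  = no λ ()
shared? second = no λ ()

opposite-≢ : ∀ {p} → p ≢ shared → opposite p ≢ p
opposite-≢ p≢shared e = p≢shared (self-opposite (sym e))

-- What a square HH carries: the involution exchanging the two copies of H, and the partition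
-- of the vertices into the labelled ones and the two copies of the unlabelled ones.
record SquareStructure (G : SGraph) : Set where
  field
    swap                     : V G → V G
    part                     : V G → Part
    swap-involutive          : ∀ x → swap (swap x) ≡ x
    swap-adj                 : ∀ x y → adj G (swap x) (swap y) ≡ adj G x y
    shared⇒fixed             : ∀ {x} → part x ≡ shared → swap x ≡ x
    part-swap                : ∀ x → part (swap x) ≡ opposite (part x)
    first-second-nonadjacent : ∀ {x y} → part x ≡ first → part y ≡ second → adj G x y ≡ false
    someFirst                : V G
    part-someFirst           : part someFirst ≡ first

  fixed⇒shared : ∀ {x} → swap x ≡ x → part x ≡ shared
  fixed⇒shared {x} e = self-opposite (trans (cong part (sym e)) (part-swap x))

  swap-injective : ∀ {x y} → swap x ≡ swap y → x ≡ y
  swap-injective {x} {y} e = trans (sym (swap-involutive x)) (trans (cong swap e) (swap-involutive y))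

  part-swap-someFirst : part (swap someFirst) ≡ second
  part-swap-someFirst = trans (part-swap someFirst) (cong opposite part-someFirst)

  dominating⇒shared : ∀ {u} → (∀ y → y ≢ u → adj G u y ≡ true) → (∀ y → y ≢ u → adj G y u ≡ true) →
                      part u ≡ shared
  dominating⇒shared {u} u-y y-u with part u in pu
  ... | shared = refl
  ... | first  = case trans (sym (first-second-nonadjacent pu part-swap-someFirst)) (u-y _ differ) of λ ()
    where
      differ : swap someFirst ≢ u
      differ e = case trans (sym part-swap-someFirst) (trans (cong part e) pu) of λ ()
  ... | second = case trans (sym (first-second-nonadjacent part-someFirst pu)) (y-u _ differ) of λ ()
    where
      differ : someFirst ≢ u
      differ e = case trans (sym part-someFirst) (trans (cong part e) pu) of λ ()

labeled-θ : ∀ {m} (H : PLGraph m) i → labeled H (θ H i) ≡ true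
labeled-θ H i = trans (isYes≗does θ⁻¹?) (dec-true θ⁻¹? (i , refl))
  where θ⁻¹? = FP.any? (λ j → θ H j F.≟ θ H i)

∉θ⇒unlabeled : ∀ {m} (H : PLGraph m) {v} → (∀ i → θ H i ≢ v) → labeled H v ≡ false
∉θ⇒unlabeled H {v} ∉θ = trans (isYes≗does θ⁻¹?) (dec-false θ⁻¹? (λ (i , e) → ∉θ i e))
  where θ⁻¹? = FP.any? (λ i → θ H i F.≟ v)

module SquareOf {m : ℕ} (H : PLGraph m) where

  copy₂ : (u : Fin m) (b : Bool) → labeled H u ≡ b → sqV H
  copy₂ u true  _ = inj₁ u
  copy₂ u false e = inj₂ (u , e)

  σ : sqV H → sqV H
  σ (inj₁ u)       = copy₂ u (labeled H u) refl
  σ (inj₂ (u , _)) = inj₁ u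

  π : sqV H → Fin m
  π (inj₁ u)       = u
  π (inj₂ (u , _)) = u

  part : sqV H → Part
  part (inj₁ u) = if labeled H u then shared else first
  part (inj₂ _) = second

  inj₂-cong : ∀ {u u′} (e : labeled H u ≡ false) (e′ : labeled H u′ ≡ false) → u ≡ u′ →
              _≡_ {A = sqV H} (inj₂ (u , e)) (inj₂ (u′ , e′))
  inj₂-cong e e′ refl = cong (λ p → inj₂ (_ , p)) (Decidable⇒UIP.≡-irrelevant _≟ᴮ_ e e′)

  σ-labeled : ∀ {u} → labeled H u ≡ true → σ (inj₁ u) ≡ inj₁ u
  σ-labeled {u} p = go (labeled H u) refl p
    where
      go : ∀ b (e : labeled H u ≡ b) → b ≡ true → copy₂ u b e ≡ inj₁ u
      go true _ _ = refl

  σ-unlabeled : ∀ {u} (e : labeled H u ≡ false) → σ (inj₁ u) ≡ inj₂ (u , e)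
  σ-unlabeled {u} e = go (labeled H u) refl
    where
      go : ∀ b (e′ : labeled H u ≡ b) → copy₂ u b e′ ≡ inj₂ (u , e)
      go false e′ = inj₂-cong e′ e refl
      go true  e′ = case trans (sym e′) e of λ ()

  part-inFirst : ∀ {u} → labeled H u ≡ false → part (inj₁ u) ≡ first
  part-inFirst = cong (if_then shared else first)

  data View : sqV H → Set where
    inBoth   : ∀ u → labeled H u ≡ true → View (inj₁ u)
    inFirst  : ∀ u (e : labeled H u ≡ false) → View (inj₁ u)
    inSecond : ∀ u (e : labeled H u ≡ false) → View (inj₂ (u , e))

  view : ∀ x → View x
  view (inj₁ u) with labeled H u in eq
  ... | true  = inBoth u eq
  ... | false = inFirst u eq
  view (inj₂ (u , e)) = inSecond u e

  σ-involutive : ∀ x → σ (σ x) ≡ x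
  σ-involutive x with view x
  ... | inBoth u p   rewrite σ-labeled p | σ-labeled p = refl
  ... | inFirst u e  rewrite σ-unlabeled e = refl
  ... | inSecond u e = σ-unlabeled e

  part-σ : ∀ x → part (σ x) ≡ opposite (part x)
  part-σ x with view x
  ... | inBoth u p   rewrite σ-labeled p | p = refl
  ... | inFirst u e  rewrite σ-unlabeled e | e = refl
  ... | inSecond u e rewrite e = refl

  shared⇒σ-fixed : ∀ {x} → part x ≡ shared → σ x ≡ x
  shared⇒σ-fixed {x} s with view x
  ... | inBoth u p   = σ-labeled p
  ... | inFirst u e  = case trans (sym (part-inFirst e)) s of λ ()
  ... | inSecond u e = case s of λ ()

  first-second-nonadjacent : ∀ {x y} → part x ≡ first → part y ≡ second → sqAdj H x y ≡ false
  first-second-nonadjacent {x} {y} px py with view x | view y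
  ... | inBoth u p   | _ rewrite p = case px of λ ()
  ... | inSecond u e | _ = case px of λ ()
  ... | inFirst u e  | inBoth v q   rewrite q = case py of λ ()
  ... | inFirst u e  | inFirst v e′ rewrite e′ = case py of λ ()
  ... | inFirst u e  | inSecond v e′ rewrite e = refl

  σ-adj : ∀ x y → sqAdj H (σ x) (σ y) ≡ sqAdj H x y
  σ-adj x y with view x | view y
  ... | inBoth u p   | inBoth v q   rewrite σ-labeled p | σ-labeled q = refl
  ... | inBoth u p   | inFirst v q  rewrite σ-labeled p | σ-unlabeled q | p = refl
  ... | inBoth u p   | inSecond v q rewrite σ-labeled p | p = refl
  ... | inFirst u p  | inBoth v q   rewrite σ-unlabeled p | σ-labeled q | q = refl
  ... | inFirst u p  | inFirst v q  rewrite σ-unlabeled p | σ-unlabeled q = refl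
  ... | inFirst u p  | inSecond v q rewrite σ-unlabeled p | p | q = refl
  ... | inSecond u p | inBoth v q   rewrite σ-labeled q | q = refl
  ... | inSecond u p | inFirst v q  rewrite σ-unlabeled q | p | q = refl
  ... | inSecond u p | inSecond v q = refl

  π-σ : ∀ x → π (σ x) ≡ π x
  π-σ x with view x
  ... | inBoth u p   rewrite σ-labeled p = refl
  ... | inFirst u e  rewrite σ-unlabeled e = refl
  ... | inSecond u e = refl

  inj₁-π : ∀ x → inj₁ (π x) ≡ x ⊎ inj₁ (π x) ≡ σ x
  inj₁-π x with view x
  ... | inBoth u p   = inj₁ refl
  ... | inFirst u e  = inj₁ refl
  ... | inSecond u e = inj₂ refl

  labeled-π : ∀ x → labeled H (π x) ≡ isShared (part x)
  labeled-π x with view x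
  ... | inBoth u p   rewrite p = refl
  ... | inFirst u e  rewrite e = refl
  ... | inSecond u e = e

  sqAdj-π : ∀ {side x y} → OnSide side (part x) → OnSide side (part y) →
            sqAdj H x y ≡ adjG (graph H) (π x) (π y)
  sqAdj-π {side} {x} {y} sx sy with view x | view y
  ... | inBoth u p   | inBoth v q   = refl
  ... | inBoth u p   | inFirst v q  = refl
  ... | inBoth u p   | inSecond v q rewrite p = refl
  ... | inFirst u p  | inBoth v q   = refl
  ... | inFirst u p  | inFirst v q  = refl
  ... | inFirst u p  | inSecond v q = ⊥-elim (opposite-sides (subst (OnSide side) (part-inFirst p) sx) sy)
  ... | inSecond u p | inBoth v q   rewrite q = refl
  ... | inSecond u p | inFirst v q  = ⊥-elim (opposite-sides (subst (OnSide side) (part-inFirst q) sy) sx)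
  ... | inSecond u p | inSecond v q = refl

  structure : SquareStructure (square H)
  structure = record
    { swap                     = σ
    ; part                     = part
    ; swap-involutive          = σ-involutive
    ; swap-adj                 = σ-adj
    ; shared⇒fixed             = shared⇒σ-fixed
    ; part-swap                = part-σ
    ; first-second-nonadjacent = λ {x} {y} → first-second-nonadjacent {x} {y}
    ; someFirst                = inj₁ (proj₁ (proper H))
    ; part-someFirst           = part-inFirst (∉θ⇒unlabeled H (proj₂ (proper H)))
    }

transport : ∀ {G G′} → G ≅ G′ → SquareStructure G → SquareStructure G′
transport {G} {G′} φ S = record
  { swap                     = λ y → to (swap (from y))
  ; part                     = λ y → part (from y)
  ; swap-involutive          = λ y → trans (cong (to ∘ swap) (from-to (swap (from y))))
                                           (trans (cong to (swap-involutive (from y))) (to-from y))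
  ; swap-adj                 = λ x y → begin
      adj G′ (to (swap (from x))) (to (swap (from y))) ≡⟨ pres (swap (from x)) (swap (from y)) ⟨
      adj G (swap (from x)) (swap (from y))           ≡⟨ swap-adj (from x) (from y) ⟩
      adj G (from x) (from y)                         ≡⟨ pres (from x) (from y) ⟩
      adj G′ (to (from x)) (to (from y))              ≡⟨ cong₂ (adj G′) (to-from x) (to-from y) ⟩
      adj G′ x y                                      ∎
  ; shared⇒fixed             = λ {y} s → trans (cong to (shared⇒fixed s)) (to-from y)
  ; part-swap                = λ y → trans (cong part (from-to (swap (from y)))) (part-swap (from y))
  ; first-second-nonadjacent = λ {x} {y} px py → begin
      adj G′ x y                         ≡⟨ cong₂ (adj G′) (to-from x) (to-from y) ⟨
      adj G′ (to (from x)) (to (from y)) ≡⟨ pres (from x) (from y) ⟨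
      adj G (from x) (from y)            ≡⟨ first-second-nonadjacent px py ⟩
      false                              ∎
  ; someFirst                = to someFirst
  ; part-someFirst           = trans (cong part (from-to someFirst)) part-someFirst
  }
  where
    open SquareStructure S
    open _≅_ φ
    open ≡-Reasoning
    to   = Inverse.to bij
    from = Inverse.from bij
    to-from = Inverse.strictlyInverseˡ bij
    from-to = Inverse.strictlyInverseʳ bij

-- Square structures on the wheel and on its rim

cycle : ℕ → SGraph
cycle n = record { V = Fin n ; adj = cycAdj n }

module Rim {n : ℕ} (S : SquareStructure (wheel n)) where
  open SquareStructure S

  hub-shared : part F.zero ≡ shared
  hub-shared = dominating⇒shared hub-y y-hub
    where
      hub-y : ∀ y → y ≢ F.zero → wheelAdj n F.zero y ≡ true
      hub-y F.zero    y≢hub = ⊥-elim (y≢hub refl)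
      hub-y (F.suc y) _     = refl
      y-hub : ∀ y → y ≢ F.zero → wheelAdj n y F.zero ≡ true
      y-hub F.zero    y≢hub = ⊥-elim (y≢hub refl)
      y-hub (F.suc y) _     = refl

  swap-hub : swap F.zero ≡ F.zero
  swap-hub = shared⇒fixed hub-shared

  swap-suc : ∀ y → Σ (Fin n) λ z → swap (F.suc y) ≡ F.suc z
  swap-suc y with swap (F.suc y) in e
  ... | F.zero  = case swap-injective (trans e (sym swap-hub)) of λ ()
  ... | F.suc z = z , refl

  rimSwap : Fin n → Fin n
  rimSwap y = proj₁ (swap-suc y)

  swap-rim : ∀ y → swap (F.suc y) ≡ F.suc (rimSwap y)
  swap-rim y = proj₂ (swap-suc y)

  rimFirst : Σ (Fin n) λ y → part (F.suc y) ≡ first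
  rimFirst with someFirst | part-someFirst
  ... | F.zero  | p = case trans (sym hub-shared) p of λ ()
  ... | F.suc y | p = y , p

  rim : SquareStructure (cycle n)
  rim = record
    { swap                     = rimSwap
    ; part                     = λ y → part (F.suc y)
    ; swap-involutive          = λ y → FP.suc-injective (begin
        F.suc (rimSwap (rimSwap y)) ≡⟨ swap-rim (rimSwap y) ⟨
        swap (F.suc (rimSwap y))    ≡⟨ cong swap (swap-rim y) ⟨
        swap (swap (F.suc y))       ≡⟨ swap-involutive (F.suc y) ⟩
        F.suc y                     ∎)
    ; swap-adj                 = λ x y → trans (sym (cong₂ (wheelAdj n) (swap-rim x) (swap-rim y)))
                                               (swap-adj (F.suc x) (F.suc y))
    ; shared⇒fixed             = λ {y} s → FP.suc-injective (trans (sym (swap-rim y)) (shared⇒fixed s))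
    ; part-swap                = λ y → trans (cong part (sym (swap-rim y))) (part-swap (F.suc y))
    ; first-second-nonadjacent = first-second-nonadjacent
    ; someFirst                = proj₁ rimFirst
    ; part-someFirst           = proj₂ rimFirst
    }
    where open ≡-Reasoning

record Halving {n′ : ℕ} (S : SquareStructure (cycle (suc n′))) : Set where
  open SquareStructure S
  field
    half          : ℕ
    half+half     : half + half ≡ suc n′
    base          : Fin (suc n′)
    side          : Part
    side≢shared   : side ≢ shared
    part-base     : part base ≡ shared
    part-half     : part (rotate half base) ≡ shared
    part-interior : ∀ l → 0 < l → l < half → part (rotate l base) ≡ side
    swap-reflects : ReflectsAt swap base

module CycleAnalysis {n₃ : ℕ} (S : SquareStructure (cycle (3 + n₃))) where
  open SquareStructure S

  private
    n : ℕ
    n = 3 + n₃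

  swap-isAutomorphism : IsCycleAutomorphism swap
  swap-isAutomorphism = record { preserves = swap-adj ; injective = swap-injective }

  part-next : ∀ x → part x ≢ shared → part (next x) ≢ shared → part (next x) ≡ part x
  part-next x x≢shared nx≢shared with part x in px | part (next x) in pnx
  ... | shared | _      = ⊥-elim (x≢shared refl)
  ... | _      | shared = ⊥-elim (nx≢shared refl)
  ... | first  | first  = refl
  ... | second | second = refl
  ... | first  | second = case trans (sym (first-second-nonadjacent px pnx)) (cycAdj-next x) of λ ()
  ... | second | first  =
    case trans (sym (first-second-nonadjacent pnx px)) (trans (cycAdj-sym (next x) x) (cycAdj-next x)) of λ ()

  record SharedAhead (x : Fin n) (j : ℕ) : Set where
    field
      steps       : ℕ
      steps≤j     : steps ≤ j
      part-steps  : part (rotate steps x) ≡ shared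
      part-before : ∀ l → l < steps → part (rotate l x) ≡ part x

  -- A walk along the rim cannot pass from one copy to the other without meeting a shared vertex.
  walk : ∀ {x} → part x ≢ shared → ∀ j → (∀ l → l ≤ j → part (rotate l x) ≡ part x) ⊎ SharedAhead x j
  walk x≢shared zero = inj₁ λ l l≤0 → cong (λ k → part (rotate k _)) (n≤0⇒n≡0 l≤0)
  walk {x} x≢shared (suc j) with walk x≢shared j
  ... | inj₂ ahead = inj₂ record { SharedAhead ahead ; steps≤j = m≤n⇒m≤1+n (SharedAhead.steps≤j ahead) }
  ... | inj₁ same with shared? (part (rotate (suc j) x))
  ...   | yes s  = inj₂ record
                     { steps = suc j ; steps≤j = ≤-refl ; part-steps = s
                     ; part-before = λ l l<sj → same l (s≤s⁻¹ l<sj) }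
  ...   | no ¬s = inj₁ λ l l≤sj → extend l (m≤n⇒m<n∨m≡n l≤sj)
    where
      extend : ∀ l → l < suc j ⊎ l ≡ suc j → part (rotate l x) ≡ part x
      extend l (inj₁ l<sj) = same l (s≤s⁻¹ l<sj)
      extend l (inj₂ refl) =
        trans (part-next (rotate j x) (λ s → x≢shared (trans (sym (same j ≤-refl)) s)) ¬s) (same j ≤-refl)

  sharedAhead : ∀ {x} → part x ≢ shared → ∀ j → part (rotate j x) ≢ part x → SharedAhead x j
  sharedAhead x≢shared j changed with walk x≢shared j
  ... | inj₁ same  = ⊥-elim (changed (same j ≤-refl))
  ... | inj₂ ahead = ahead

  sharedVertex : Σ (Fin n) λ a → part a ≡ shared
  sharedVertex = rotate steps someFirst , part-steps
    where
      first≢shared : part someFirst ≢ shared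
      first≢shared e = case trans (sym part-someFirst) e of λ ()
      second≢first : part (rotate (position someFirst (swap someFirst)) someFirst) ≢ part someFirst
      second≢first e = case trans (sym part-swap-someFirst)
                              (trans (cong part (sym (rotate-position someFirst (swap someFirst))))
                                     (trans e part-someFirst)) of λ ()
      open SharedAhead (sharedAhead first≢shared (position someFirst (swap someFirst)) second≢first)

  module _ {a : Fin n} (part-a : part a ≡ shared) where

    private
      swap-a : swap a ≡ a
      swap-a = shared⇒fixed part-a

      r : Fin n → Fin n
      r = reflectionAt a

      r-reflects : ReflectsAt r a
      r-reflects = reflectionAt-reflects a

      r-a : r a ≡ a
      r-a = trans (r-reflects 0 z≤n) (rotate-n a)

    -- swap sends next a to a neighbour of a = swap a.  Fixing next a would make swap the identity,
    -- which it is not on someFirst; so swap (next a) precedes a, as for the reflection at a.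
    swap-reflects : ReflectsAt swap a
    swap-reflects j j≤n = trans (swap≗r (rotate j a)) (r-reflects j j≤n)
      where
        neighbour : Adjacent a (swap (next a))
        neighbour = subst (λ v → Adjacent v (swap (next a))) swap-a
                          (IsCycleAutomorphism.adjacent-images swap-isAutomorphism (cycAdj-next a))
        swap≗r : ∀ x → swap x ≡ r x
        swap≗r with neighbour
        ... | inj₁ fixes-next = case trans (sym part-someFirst) (fixed⇒shared (swap≗id someFirst)) of λ ()
          where
            swap≗id : ∀ x → swap x ≡ x
            swap≗id = automorphisms-agree (s≤s (s≤s (s≤s z≤n))) swap-isAutomorphism id-isAutomorphism
                                          a swap-a fixes-next
        ... | inj₂ flips-next = automorphisms-agree (s≤s (s≤s (s≤s z≤n)))
            swap-isAutomorphism (reflection-isAutomorphism {t = r} {a = a} r-reflects) a (trans swap-a (sym r-a))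
            (next-injective (trans (sym flips-next) (sym (trans (reflection-next {t = r} {a = a} r-reflects a) r-a))))

    -- The first shared vertex after a is fixed by the reflection at a, hence antipodal to a.
    halving : Halving S
    halving = record
      { half          = half
      ; half+half     = trans (cong (half +_) half≡n∸half) (m+[n∸m]≡n (<⇒≤ half<n))
      ; base          = a
      ; side          = side
      ; side≢shared   = side≢shared
      ; part-base     = part-a
      ; part-half     = part-half
      ; part-interior = interior
      ; swap-reflects = swap-reflects
      }
      where
        side : Part
        side = part (next a)

        swap-next : swap (next a) ≡ rotate (n ∸ 1) a
        swap-next = swap-reflects 1 (s≤s z≤n)

        side≢shared : side ≢ shared
        side≢shared s =
          case rotate-injectiveˡ a ≤-refl (s≤s (s≤s z≤n)) (trans (sym swap-next) (shared⇒fixed s)) of λ ()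

        last-opposite : part (rotate (n ∸ 2) (next a)) ≢ side
        last-opposite e = opposite-≢ side≢shared (begin
          opposite side                 ≡⟨ part-swap (next a) ⟨
          part (swap (next a))          ≡⟨ cong part swap-next ⟩
          part (rotate (n ∸ 1) a)       ≡⟨ cong part (rotate-comm (n ∸ 2) 1 a) ⟨
          part (rotate (n ∸ 2) (next a)) ≡⟨ e ⟩
          side                          ∎)
          where open ≡-Reasoning

        open SharedAhead (sharedAhead side≢shared (n ∸ 2) last-opposite)

        half : ℕ
        half = suc steps

        rotate-half : rotate half a ≡ rotate steps (next a)
        rotate-half = sym (rotate-comm steps 1 a)

        half<n : half < n
        half<n = s≤s (s≤s steps≤j)

        part-half : part (rotate half a) ≡ shared
        part-half = trans (cong part rotate-half) part-steps

        half≡n∸half : half ≡ n ∸ half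
        half≡n∸half = rotate-injectiveˡ a half<n (∸-monoʳ-< {n} {half} {0} (s≤s z≤n) (<⇒≤ half<n))
                        (trans (sym (shared⇒fixed part-half)) (swap-reflects half (<⇒≤ half<n)))

        interior : ∀ l → 0 < l → l < half → part (rotate l a) ≡ side
        interior (suc l) _ l<half = trans (cong part (rotate-comm 1 l a)) (part-before l (s≤s⁻¹ l<half))

-- Foldings

-- fold identifies exactly the swap-orbits of G, and embed picks a representative of each.
record Folding (G : SGraph) (swap : V G → V G) {k : ℕ} (P : Graph k) : Set where
  field
    fold            : V G → Fin k
    embed           : Fin k → V G
    swap-involutive : ∀ y → swap (swap y) ≡ y
    swap-adj        : ∀ x y → adj G (swap x) (swap y) ≡ adj G x y
    fold-embed      : ∀ i → fold (embed i) ≡ i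
    fold-swap       : ∀ y → fold (swap y) ≡ fold y
    embed-fold      : ∀ y → embed (fold y) ≡ y ⊎ embed (fold y) ≡ swap y
    embed-adj       : ∀ i j → adj G (embed i) (embed j) ≡ adjG P i j

module _ {m k : ℕ} {G : SGraph} (H : PLGraph m) (φ : square H ≅ G) (P : PLGraph k) where
  open SquareOf H using (π; σ; π-σ; inj₁-π; labeled-π; sqAdj-π)
  private
    S = transport φ (SquareOf.structure H)
    to   = Inverse.to (_≅_.bij φ)
    from = Inverse.from (_≅_.bij φ)
    to-from = Inverse.strictlyInverseˡ (_≅_.bij φ)
    from-to = Inverse.strictlyInverseʳ (_≅_.bij φ)

  folding⇒≅PL : (F : Folding G (SquareStructure.swap S) (graph P)) → ∀ side → side ≢ shared →
               (∀ i → SquareStructure.part S (Folding.embed F i) ≡ (if labeled P i then shared else side)) →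
               H ≅PL P
  folding⇒≅PL F side side≢shared part-embed = record
    { iso    = record
      { bij  = mk↔ₛ′ f g f-g g-f
      ; pres = λ u v → trans (cong₂ (adjG (graph H)) (sym (g-f u)) (sym (g-f v))) (adj-g (f u) (f v))
      }
    ; labels = λ v → trans (cong (labeled H) (sym (g-f v))) (labels-g (f v))
    }
    where
      open Folding F

      f : Fin m → Fin k
      f v = fold (to (inj₁ v))

      g : Fin k → Fin m
      g i = π (from (embed i))

      g-f : ∀ v → g (f v) ≡ v
      g-f v with embed-fold (to (inj₁ v))
      ... | inj₁ e = trans (cong (π ∘ from) e) (cong π (from-to (inj₁ v)))
      ... | inj₂ e = begin
        π (from (embed (fold (to (inj₁ v)))))           ≡⟨ cong (π ∘ from) e ⟩
        π (from (to (σ (from (to (inj₁ v))))))          ≡⟨ cong π (from-to (σ (from (to (inj₁ v))))) ⟩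
        π (σ (from (to (inj₁ v))))                      ≡⟨ π-σ (from (to (inj₁ v))) ⟩
        π (from (to (inj₁ v)))                          ≡⟨ cong π (from-to (inj₁ v)) ⟩
        v                                               ∎
        where open ≡-Reasoning

      f-g : ∀ i → f (g i) ≡ i
      f-g i with inj₁-π (from (embed i))
      ... | inj₁ e = trans (cong (fold ∘ to) e) (trans (cong fold (to-from (embed i))) (fold-embed i))
      ... | inj₂ e = trans (cong (fold ∘ to) e) (trans (fold-swap (embed i)) (fold-embed i))

      onSide : ∀ i → OnSide side (SquareStructure.part S (embed i))
      onSide i with labeled P i | part-embed i
      ... | true  | e = inj₁ e
      ... | false | e = inj₂ e

      adj-g : ∀ i j → adjG (graph H) (g i) (g j) ≡ adjG (graph P) i j
      adj-g i j = begin
        adjG (graph H) (π x) (π y)    ≡⟨ sqAdj-π {side} {x} {y} (onSide i) (onSide j) ⟨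
        sqAdj H x y                   ≡⟨ _≅_.pres φ x y ⟩
        adj G (to x) (to y)           ≡⟨ cong₂ (adj G) (to-from (embed i)) (to-from (embed j)) ⟩
        adj G (embed i) (embed j)     ≡⟨ embed-adj i j ⟩
        adjG (graph P) i j            ∎
        where
          open ≡-Reasoning
          x = from (embed i)
          y = from (embed j)

      labels-g : ∀ i → labeled H (g i) ≡ labeled P i
      labels-g i =
        trans (labeled-π (from (embed i))) (trans (cong isShared (part-embed i)) (isShared-if (labeled P i)))
        where
          isShared-if : ∀ b → isShared (if b then shared else side) ≡ b
          isShared-if true  = refl
          isShared-if false = isShared-≢ side≢shared

module _ {k : ℕ} {G : SGraph} (P : PLGraph k) {swap : V G → V G} (F : Folding G swap (graph P))
         (_≟ᴳ_ : DecidableEquality (V G)) (adj-sym : ∀ x y → adj G x y ≡ adj G y x) where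
  open Folding F

  folding⇒square≅ :
    (∀ {i} → labeled P i ≡ true → swap (embed i) ≡ embed i) →
    (∀ {i} → swap (embed i) ≡ embed i → labeled P i ≡ true) →
    (∀ {i j} → labeled P i ≡ false → labeled P j ≡ false → adj G (embed i) (swap (embed j)) ≡ false) →
    square P ≅ G
  folding⇒square≅ labeled⇒fixed fixed⇒labeled unlabeled-nonadjacent =
    record { bij = mk↔ₛ′ glue split glue-split split-glue ; pres = pres }
    where
      glue : sqV P → V G
      glue (inj₁ u)       = embed u
      glue (inj₂ (u , _)) = swap (embed u)

      embed-moved : ∀ {y} → embed (fold y) ≢ y → embed (fold y) ≡ swap y
      embed-moved {y} moved with embed-fold y
      ... | inj₁ stays   = ⊥-elim (moved stays)
      ... | inj₂ swapped = swapped

      unlabeled-fold : ∀ {y} → embed (fold y) ≢ y → labeled P (fold y) ≡ false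
      unlabeled-fold {y} moved = ¬-not λ lab → moved (trans (embed-moved moved) (sym (y≡swap-y lab)))
        where
          y≡swap-y : labeled P (fold y) ≡ true → y ≡ swap y
          y≡swap-y lab = begin
            y                       ≡⟨ swap-involutive y ⟨
            swap (swap y)           ≡⟨ cong swap (embed-moved moved) ⟨
            swap (embed (fold y))   ≡⟨ labeled⇒fixed lab ⟩
            embed (fold y)          ≡⟨ embed-moved moved ⟩
            swap y                  ∎
            where open ≡-Reasoning

      split : V G → sqV P
      split y with embed (fold y) ≟ᴳ y
      ... | yes _     = inj₁ (fold y)
      ... | no  moved = inj₂ (fold y , unlabeled-fold moved)

      glue-split : ∀ y → glue (split y) ≡ y
      glue-split y with embed (fold y) ≟ᴳ y
      ... | yes stays = stays
      ... | no  moved = trans (cong swap (embed-moved moved)) (swap-involutive y)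

      split-glue : ∀ x → split (glue x) ≡ x
      split-glue (inj₁ u) with embed (fold (embed u)) ≟ᴳ embed u
      ... | yes _     = cong inj₁ (fold-embed u)
      ... | no  moved = ⊥-elim (moved (cong embed (fold-embed u)))
      split-glue (inj₂ (u , ¬lu)) with embed (fold (swap (embed u))) ≟ᴳ swap (embed u)
      ... | yes stays = case trans (sym (fixed⇒labeled fixed)) ¬lu of λ ()
        where
          fixed : swap (embed u) ≡ embed u
          fixed = trans (sym stays) (cong embed (trans (fold-swap (embed u)) (fold-embed u)))
      ... | no  _     = SquareOf.inj₂-cong P _ ¬lu (trans (fold-swap (embed u)) (fold-embed u))

      pres : ∀ x y → sqAdj P x y ≡ adj G (glue x) (glue y)
      pres (inj₁ u)       (inj₁ v)       = sym (embed-adj u v)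
      pres (inj₂ (u , _)) (inj₂ (v , _)) = sym (trans (swap-adj (embed u) (embed v)) (embed-adj u v))
      pres (inj₁ u) (inj₂ (v , ¬lv)) with labeled P u in lu
      ... | true  = sym (begin
        adj G (embed u) (swap (embed v))          ≡⟨ cong (λ z → adj G z (swap (embed v))) (labeled⇒fixed lu) ⟨
        adj G (swap (embed u)) (swap (embed v))   ≡⟨ swap-adj (embed u) (embed v) ⟩
        adj G (embed u) (embed v)                 ≡⟨ embed-adj u v ⟩
        adjG (graph P) u v                        ∎)
        where open ≡-Reasoning
      ... | false = sym (unlabeled-nonadjacent lu ¬lv)
      pres (inj₂ (u , ¬lu)) (inj₁ v) with labeled P v in lv
      ... | true  = sym (begin
        adj G (swap (embed u)) (embed v)          ≡⟨ cong (adj G (swap (embed u))) (labeled⇒fixed lv) ⟨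
        adj G (swap (embed u)) (swap (embed v))   ≡⟨ swap-adj (embed u) (embed v) ⟩
        adj G (embed u) (embed v)                 ≡⟨ embed-adj u v ⟩
        adjG (graph P) u v                        ∎)
        where open ≡-Reasoning
      ... | false = sym (trans (adj-sym (swap (embed u)) (embed v)) (unlabeled-nonadjacent lv ¬lu))

module _ {m₁ m₂ : ℕ} {H₁ : PLGraph m₁} {H₂ : PLGraph m₂} where

  ≅PL-sym : H₁ ≅PL H₂ → H₂ ≅PL H₁
  ≅PL-sym H₁≅H₂ = record
    { iso    = record
      { bij  = ↔-sym bij
      ; pres = λ u v → sym (trans (pres (from u) (from v)) (cong₂ (adjG (graph H₂)) (to-from u) (to-from v)))
      }
    ; labels = λ v → sym (trans (labels (from v)) (cong (labeled H₂) (to-from v)))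
    }
    where
      open _≅PL_ H₁≅H₂
      open _≅_ iso
      from    = Inverse.from bij
      to-from = Inverse.strictlyInverseˡ bij

  ≅PL-trans : ∀ {m₃} {H₃ : PLGraph m₃} → H₁ ≅PL H₂ → H₂ ≅PL H₃ → H₁ ≅PL H₃
  ≅PL-trans H₁≅H₂ H₂≅H₃ = record
    { iso    = record
      { bij  = ↔-trans (_≅_.bij (_≅PL_.iso H₁≅H₂)) (_≅_.bij (_≅PL_.iso H₂≅H₃))
      ; pres = λ u v → trans (_≅_.pres (_≅PL_.iso H₁≅H₂) u v) (_≅_.pres (_≅PL_.iso H₂≅H₃) _ _)
      }
    ; labels = λ v → trans (_≅PL_.labels H₁≅H₂ v) (_≅PL_.labels H₂≅H₃ _)
    }

-- The fan, and the folding of the wheel onto it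

-- Vertex 0 is the hub and vertex suc j the j-th vertex of the path 0, …, M; the hub and the
-- two ends of the path are labelled.
module Fan (m₀ : ℕ) where

  M : ℕ
  M = 2 + m₀

  pathAdj : Fin (suc M) → Fin (suc M) → Bool
  pathAdj i j = (toℕ j ≡ᵇ suc (toℕ i)) ∨ (toℕ i ≡ᵇ suc (toℕ j))

  fanAdj : Fin (2 + M) → Fin (2 + M) → Bool
  fanAdj F.zero    F.zero    = false
  fanAdj F.zero    (F.suc j) = true
  fanAdj (F.suc i) F.zero    = true
  fanAdj (F.suc i) (F.suc j) = pathAdj i j

  fanGraph : Graph (2 + M)
  fanGraph = record { adjG = fanAdj ; sym = fanAdj-sym ; irrefl = fanAdj-irrefl }
    where
      fanAdj-sym : ∀ u v → fanAdj u v ≡ fanAdj v u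
      fanAdj-sym F.zero    F.zero    = refl
      fanAdj-sym F.zero    (F.suc j) = refl
      fanAdj-sym (F.suc i) F.zero    = refl
      fanAdj-sym (F.suc i) (F.suc j) = ∨-comm (toℕ j ≡ᵇ suc (toℕ i)) (toℕ i ≡ᵇ suc (toℕ j))
      fanAdj-irrefl : ∀ v → fanAdj v v ≡ false
      fanAdj-irrefl F.zero    = refl
      fanAdj-irrefl (F.suc i) = cong (λ b → b ∨ b) (dec-false (toℕ i ≟ suc (toℕ i)) (λ e → 1+n≢n (sym e)))

  ends : Fin 3 → Fin (2 + M)
  ends F.zero                   = F.zero
  ends (F.suc F.zero)           = F.suc F.zero
  ends (F.suc (F.suc F.zero))   = F.suc (F.fromℕ M)

  ends-injective : ∀ {i j} → ends i ≡ ends j → i ≡ j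
  ends-injective {F.zero}                 {F.zero}                 _  = refl
  ends-injective {F.suc F.zero}           {F.suc F.zero}           _  = refl
  ends-injective {F.suc (F.suc F.zero)}   {F.suc (F.suc F.zero)}   _  = refl
  ends-injective {F.zero}                 {F.suc F.zero}           ()
  ends-injective {F.zero}                 {F.suc (F.suc F.zero)}   ()
  ends-injective {F.suc F.zero}           {F.zero}                 ()
  ends-injective {F.suc F.zero}           {F.suc (F.suc F.zero)}   ()
  ends-injective {F.suc (F.suc F.zero)}   {F.zero}                 ()
  ends-injective {F.suc (F.suc F.zero)}   {F.suc F.zero}           ()

  fan : PLGraph (2 + M)
  fan = record
    { graph    = fanGraph
    ; k        = 3
    ; lab      = toℕ
    ; lab-inj  = FP.toℕ-injective
    ; θ        = ends
    ; θ-inj    = ends-injective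
    ; nonempty = s≤s z≤n
    ; proper   = F.suc (F.suc F.zero) , λ { F.zero () ; (F.suc F.zero) () ; (F.suc (F.suc F.zero)) () }
    }

  data FanVertex : Fin (2 + M) → Set where
    hub   : FanVertex F.zero
    start : ∀ {j} → toℕ j ≡ 0 → FanVertex (F.suc j)
    end   : ∀ {j} → toℕ j ≡ M → FanVertex (F.suc j)
    inner : ∀ {j} → 0 < toℕ j → toℕ j < M → FanVertex (F.suc j)

  fanVertex : ∀ v → FanVertex v
  fanVertex F.zero = hub
  fanVertex (F.suc j) with toℕ j ≟ 0 | toℕ j ≟ M
  ... | yes j≡0 | _       = start j≡0
  ... | no  _   | yes j≡M = end j≡M
  ... | no  j≢0 | no  j≢M = inner (n≢0⇒n>0 j≢0) (≤∧≢⇒< (s≤s⁻¹ (FP.toℕ<n j)) j≢M)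

  labeled-hub : labeled fan F.zero ≡ true
  labeled-hub = labeled-θ fan F.zero

  labeled-start : ∀ {j} → toℕ j ≡ 0 → labeled fan (F.suc j) ≡ true
  labeled-start j≡0 = subst (λ v → labeled fan v ≡ true) (cong F.suc (FP.toℕ-injective (sym j≡0)))
                            (labeled-θ fan (F.suc F.zero))

  labeled-end : ∀ {j} → toℕ j ≡ M → labeled fan (F.suc j) ≡ true
  labeled-end j≡M = subst (λ v → labeled fan v ≡ true)
                          (cong F.suc (FP.toℕ-injective (trans (FP.toℕ-fromℕ M) (sym j≡M))))
                          (labeled-θ fan (F.suc (F.suc F.zero)))

  unlabeled⇒inner : ∀ {v} → labeled fan v ≡ false → Σ (Fin (suc M)) λ j → v ≡ F.suc j × 0 < toℕ j × toℕ j < M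
  unlabeled⇒inner {v} ¬lv with fanVertex v
  ... | hub         = case trans (sym labeled-hub) ¬lv of λ ()
  ... | start j≡0   = case trans (sym (labeled-start j≡0)) ¬lv of λ ()
  ... | end j≡M     = case trans (sym (labeled-end j≡M)) ¬lv of λ ()
  ... | inner 0<j j<M = _ , refl , 0<j , j<M

  labeled-inner : ∀ {j} → 0 < toℕ j → toℕ j < M → labeled fan (F.suc j) ≡ false
  labeled-inner {j} 0<j j<M = ∉θ⇒unlabeled fan λ
    { F.zero                 ()
    ; (F.suc F.zero)         e → <-irrefl (cong toℕ (FP.suc-injective e)) 0<j
    ; (F.suc (F.suc F.zero)) e → <-irrefl (trans (sym (cong toℕ (FP.suc-injective e))) (FP.toℕ-fromℕ M)) j<M
    }

onRim : ∀ {n} → (Fin n → Fin n) → Fin (suc n) → Fin (suc n)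
onRim t F.zero    = F.zero
onRim t (F.suc y) = F.suc (t y)

module FanFolding (m₀ : ℕ) {n′ : ℕ} (M+M≡n : Fan.M m₀ + Fan.M m₀ ≡ suc n′)
                  {t : Fin (suc n′) → Fin (suc n′)} {a : Fin (suc n′)} (t-reflects : ReflectsAt t a)
                  (swap : Fin (suc (suc n′)) → Fin (suc (suc n′)))
                  (swap-hub : swap F.zero ≡ F.zero) (swap-rim : ∀ y → swap (F.suc y) ≡ F.suc (t y)) where
  open Fan m₀

  private
    n : ℕ
    n = suc n′

  n∸M≡M : n ∸ M ≡ M
  n∸M≡M = trans (cong (_∸ M) (sym M+M≡n)) (m+n∸m≡n M M)

  M≤n : M ≤ n
  M≤n = subst (M ≤_) M+M≡n (m≤m+n M M)

  1+M<n : suc M < n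
  1+M<n = subst (2 + M ≤_) M+M≡n (+-monoˡ-≤ M (s≤s (s≤s (z≤n {m₀}))))

  M<n : M < n
  M<n = <-trans (n<1+n M) 1+M<n

  <M⇒<n : ∀ {j} → j < M → j < n
  <M⇒<n j<M = <-trans j<M M<n

  <M⇒≤n : ∀ {j} → j < M → j ≤ n
  <M⇒≤n j<M = <⇒≤ (<M⇒<n j<M)

  n∸j<n : ∀ {j} → 0 < j → j ≤ n → n ∸ j < n
  n∸j<n {j} 0<j j≤n = ∸-monoʳ-< {n} {j} {0} 0<j j≤n

  M≤n∸ : ∀ {j} → j ≤ M → M ≤ n ∸ j
  M≤n∸ {j} j≤M = subst (_≤ n ∸ j) n∸M≡M (∸-monoʳ-≤ n j≤M)

  M<n∸ : ∀ {j} → j < M → M < n ∸ j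
  M<n∸ {j} j<M = subst (_< n ∸ j) n∸M≡M (∸-monoʳ-< {n} {M} {j} j<M M≤n)

  distance : Fin n → ℕ
  distance y = position a y ⊓ (n ∸ position a y)

  distance-rotate : ∀ j → j ≤ n → distance (rotate j a) ≡ j ⊓ (n ∸ j)
  distance-rotate j j≤n with m≤n⇒m<n∨m≡n j≤n
  ... | inj₁ j<n  = cong (λ l → l ⊓ (n ∸ l)) (position-rotate a j<n)
  ... | inj₂ refl = begin
    distance (rotate n a) ≡⟨ cong distance (rotate-n a) ⟩
    distance a            ≡⟨ cong (λ l → l ⊓ (n ∸ l)) (position-rotate a {0} (s≤s z≤n)) ⟩
    0                     ≡⟨ ⊓-zeroʳ n ⟨
    n ⊓ 0                 ≡⟨ cong (n ⊓_) (n∸n≡0 n) ⟨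
    n ⊓ (n ∸ n)           ∎
    where open ≡-Reasoning

  distance-reflect : ∀ y → distance (t y) ≡ distance y
  distance-reflect y = begin
    distance (t y)                          ≡⟨ cong (distance ∘ t) (rotate-position a y) ⟨
    distance (t (rotate l a))               ≡⟨ cong distance (t-reflects l l≤n) ⟩
    distance (rotate (n ∸ l) a)             ≡⟨ distance-rotate (n ∸ l) (m∸n≤m n l) ⟩
    (n ∸ l) ⊓ (n ∸ (n ∸ l))                 ≡⟨ cong ((n ∸ l) ⊓_) (m∸[m∸n]≡n l≤n) ⟩
    (n ∸ l) ⊓ l                             ≡⟨ ⊓-comm (n ∸ l) l ⟩
    l ⊓ (n ∸ l)                             ∎
    where
      open ≡-Reasoning
      l = position a y
      l≤n = <⇒≤ (position<n a y)

  distance≤M : ∀ y → distance y ≤ M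
  distance≤M y with position a y ≤? M
  ... | yes l≤M = ≤-trans (m⊓n≤m _ _) l≤M
  ... | no  l≰M = ≤-trans (m⊓n≤n _ _) (subst (n ∸ position a y ≤_) n∸M≡M (∸-monoʳ-≤ n (≰⇒≥ l≰M)))

  rimIndex : Fin n → Fin (suc M)
  rimIndex y = fromℕ< (s≤s (distance≤M y))

  toℕ-rimIndex : ∀ y → toℕ (rimIndex y) ≡ distance y
  toℕ-rimIndex y = FP.toℕ-fromℕ< (s≤s (distance≤M y))

  fold : Fin (suc n) → Fin (2 + M)
  fold F.zero    = F.zero
  fold (F.suc y) = F.suc (rimIndex y)

  embed : Fin (2 + M) → Fin (suc n)
  embed F.zero    = F.zero
  embed (F.suc j) = F.suc (rotate (toℕ j) a)

  rotate-distance : ∀ y → rotate (distance y) a ≡ y ⊎ rotate (distance y) a ≡ t y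
  rotate-distance y = Sum.map
    (λ e → trans (cong (λ d → rotate d a) e) (rotate-position a y))
    (λ e → trans (cong (λ d → rotate d a) e)
                 (trans (sym (t-reflects l (<⇒≤ (position<n a y)))) (cong t (rotate-position a y))))
    (⊓-sel l (n ∸ l))
    where l = position a y

  swap≗onRim : ∀ y → swap y ≡ onRim t y
  swap≗onRim F.zero    = swap-hub
  swap≗onRim (F.suc y) = swap-rim y

  toℕ≤M : ∀ (j : Fin (suc M)) → toℕ j ≤ M
  toℕ≤M j = s≤s⁻¹ (FP.toℕ<n j)

  folding : Folding (wheel n) swap fanGraph
  folding = record
    { fold            = fold
    ; embed           = embed
    ; swap-involutive = λ y →
        trans (cong swap (swap≗onRim y)) (trans (swap≗onRim (onRim t y)) (onRim-involutive y))
    ; swap-adj        = λ x y → trans (cong₂ (wheelAdj n) (swap≗onRim x) (swap≗onRim y)) (onRim-adj x y)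
    ; fold-embed      = fold-embed
    ; fold-swap       = λ y → trans (cong fold (swap≗onRim y)) (fold-onRim y)
    ; embed-fold      = embed-fold
    ; embed-adj       = embed-adj
    }
    where
      onRim-involutive : ∀ y → onRim t (onRim t y) ≡ y
      onRim-involutive F.zero    = refl
      onRim-involutive (F.suc y) = cong F.suc (reflection-involutive {t = t} {a = a} t-reflects y)

      onRim-adj : ∀ x y → wheelAdj n (onRim t x) (onRim t y) ≡ wheelAdj n x y
      onRim-adj F.zero    F.zero    = refl
      onRim-adj F.zero    (F.suc y) = refl
      onRim-adj (F.suc x) F.zero    = refl
      onRim-adj (F.suc x) (F.suc y) = reflection-adj {t = t} {a = a} t-reflects x y

      fold-embed : ∀ i → fold (embed i) ≡ i
      fold-embed F.zero    = refl
      fold-embed (F.suc j) = cong F.suc (FP.toℕ-injective (begin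
        toℕ (rimIndex (rotate (toℕ j) a)) ≡⟨ toℕ-rimIndex (rotate (toℕ j) a) ⟩
        distance (rotate (toℕ j) a)       ≡⟨ distance-rotate (toℕ j) (≤-trans (toℕ≤M j) M≤n) ⟩
        toℕ j ⊓ (n ∸ toℕ j)               ≡⟨ m≤n⇒m⊓n≡m (≤-trans (toℕ≤M j) (M≤n∸ (toℕ≤M j))) ⟩
        toℕ j                             ∎))
        where open ≡-Reasoning

      fold-onRim : ∀ y → fold (onRim t y) ≡ fold y
      fold-onRim F.zero    = refl
      fold-onRim (F.suc y) = cong F.suc (FP.toℕ-injective
        (trans (toℕ-rimIndex (t y)) (trans (distance-reflect y) (sym (toℕ-rimIndex y)))))

      embed-fold : ∀ y → embed (fold y) ≡ y ⊎ embed (fold y) ≡ swap y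
      embed-fold F.zero    = inj₁ refl
      embed-fold (F.suc y) = Sum.map
        (λ e → cong F.suc (trans (cong (λ d → rotate d a) (toℕ-rimIndex y)) e))
        (λ e → trans (cong F.suc (trans (cong (λ d → rotate d a) (toℕ-rimIndex y)) e)) (sym (swap-rim y)))
        (rotate-distance y)

      embed-adj : ∀ i j → wheelAdj n (embed i) (embed j) ≡ fanAdj i j
      embed-adj F.zero    F.zero    = refl
      embed-adj F.zero    (F.suc j) = refl
      embed-adj (F.suc i) F.zero    = refl
      embed-adj (F.suc i) (F.suc j) = cycAdj-rotate a (toℕ i) (toℕ j) (bound i) (bound j)
        where
          bound : ∀ (i : Fin (suc M)) → suc (toℕ i) < n
          bound i = ≤-<-trans (s≤s (toℕ≤M i)) 1+M<n

  t-rotate : ∀ (j : Fin (suc M)) → t (rotate (toℕ j) a) ≡ rotate (n ∸ toℕ j) a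
  t-rotate j = t-reflects (toℕ j) (≤-trans (toℕ≤M j) M≤n)

  labeled⇒fixed : ∀ {i} → labeled fan i ≡ true → swap (embed i) ≡ embed i
  labeled⇒fixed {i} li with fanVertex i
  ... | hub = swap-hub
  ... | start {j} j≡0 = trans (swap-rim _) (cong F.suc (begin
    t (rotate (toℕ j) a)   ≡⟨ t-rotate j ⟩
    rotate (n ∸ toℕ j) a   ≡⟨ cong (λ l → rotate (n ∸ l) a) j≡0 ⟩
    rotate n a             ≡⟨ rotate-n a ⟩
    a                      ≡⟨ cong (λ l → rotate l a) j≡0 ⟨
    rotate (toℕ j) a       ∎))
    where open ≡-Reasoning
  ... | end {j} j≡M = trans (swap-rim _) (cong F.suc (begin
    t (rotate (toℕ j) a)   ≡⟨ t-rotate j ⟩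
    rotate (n ∸ toℕ j) a   ≡⟨ cong (λ l → rotate (n ∸ l) a) j≡M ⟩
    rotate (n ∸ M) a       ≡⟨ cong (λ l → rotate l a) n∸M≡M ⟩
    rotate M a             ≡⟨ cong (λ l → rotate l a) j≡M ⟨
    rotate (toℕ j) a       ∎))
    where open ≡-Reasoning
  ... | inner 0<j j<M = case trans (sym li) (labeled-inner 0<j j<M) of λ ()

  fixed⇒labeled : ∀ {i} → swap (embed i) ≡ embed i → labeled fan i ≡ true
  fixed⇒labeled {i} fixed with fanVertex i
  ... | hub         = labeled-hub
  ... | start j≡0   = labeled-start j≡0
  ... | end j≡M     = labeled-end j≡M
  ... | inner {j} 0<j j<M = ⊥-elim (<⇒≱ (M<n∸ j<M) (subst (_≤ M) (sym n∸j≡j) (<⇒≤ j<M)))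
    where
      n∸j≡j : n ∸ toℕ j ≡ toℕ j
      n∸j≡j = rotate-injectiveˡ a (n∸j<n 0<j (<M⇒≤n j<M)) (<M⇒<n j<M)
                (trans (sym (t-rotate j)) (FP.suc-injective (trans (sym (swap-rim _)) fixed)))

  no-edge-across : ∀ {i j} → 0 < i → i < M → 0 < j → j < M → ¬ Adjacent (rotate i a) (rotate (n ∸ j) a)
  no-edge-across {i} {j} _ i<M 0<j j<M (inj₁ e) = <⇒≱ (M<n∸ j<M) (subst (_≤ M) (sym n∸j≡1+i) i<M)
    where
      n∸j≡1+i : n ∸ j ≡ suc i
      n∸j≡1+i = rotate-injectiveˡ a (n∸j<n 0<j (<M⇒≤n j<M)) (≤-<-trans i<M M<n) e
  no-edge-across {i} {suc zero} 0<i i<M _ _ (inj₂ e) =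
    <-irrefl (sym (rotate-injectiveˡ a (<M⇒<n i<M) (s≤s z≤n) (trans e (rotate-n a)))) 0<i
  no-edge-across {i} {suc (suc k)} _ i<M _ j<M (inj₂ e) = <⇒≱ (M<n∸ 1+k<M) (subst (_≤ M) i≡n∸1+k (<⇒≤ i<M))
    where
      1+k<M : suc k < M
      1+k<M = <-trans (n<1+n (suc k)) j<M
      i≡n∸1+k : i ≡ n ∸ suc k
      i≡n∸1+k = rotate-injectiveˡ a (<M⇒<n i<M) (n∸j<n (s≤s z≤n) (<M⇒≤n 1+k<M))
                  (trans e (cong (λ l → rotate l a) (sym (+-∸-assoc 1 (<M⇒≤n j<M)))))

  unlabeled-nonadjacent : ∀ {i j} → labeled fan i ≡ false → labeled fan j ≡ false →
                           wheelAdj n (embed i) (swap (embed j)) ≡ false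
  unlabeled-nonadjacent ¬li ¬lj with unlabeled⇒inner ¬li | unlabeled⇒inner ¬lj
  ... | i , refl , 0<i , i<M | j , refl , 0<j , j<M = begin
    wheelAdj n (F.suc (rotate (toℕ i) a)) (swap (F.suc (rotate (toℕ j) a))) ≡⟨ cong (wheelAdj n _) (swap-rim _) ⟩
    cycAdj n (rotate (toℕ i) a) (t (rotate (toℕ j) a))                     ≡⟨ cong (cycAdj n _) (t-rotate j) ⟩
    cycAdj n (rotate (toℕ i) a) (rotate (n ∸ toℕ j) a)
      ≡⟨ ¬adjacent⇒cycAdj-false (no-edge-across 0<i i<M 0<j j<M) ⟩
    false                                                                  ∎
    where open ≡-Reasoning

wheelAdj-sym : ∀ {n′} (x y : Fin (suc (suc n′))) → wheelAdj (suc n′) x y ≡ wheelAdj (suc n′) y x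
wheelAdj-sym F.zero    F.zero    = refl
wheelAdj-sym F.zero    (F.suc y) = refl
wheelAdj-sym (F.suc x) F.zero    = refl
wheelAdj-sym (F.suc x) (F.suc y) = cycAdj-sym x y

fanSquare : ∀ m₀ → square (Fan.fan m₀) ≅ wheel (Fan.M m₀ + Fan.M m₀)
fanSquare m₀ =
  folding⇒square≅ fan folding F._≟_ wheelAdj-sym labeled⇒fixed fixed⇒labeled unlabeled-nonadjacent
  where
    open Fan m₀
    open FanFolding m₀ refl (reflectionAt-reflects F.zero) (onRim (reflectionAt F.zero)) refl (λ _ → refl)

FanRoot : ℕ → ∀ {m} → PLGraph m → Set
FanRoot n H = Σ ℕ λ m₀ → Fan.M m₀ + Fan.M m₀ ≡ n × H ≅PL Fan.fan m₀

half≥2 : ∀ {n₃} h → h + h ≡ 3 + n₃ → 2 ≤ h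
half≥2 (suc (suc h)) _ = s≤s (s≤s z≤n)

module _ {n₃ m : ℕ} (H : PLGraph m) (φ : square H ≅ wheel (3 + n₃)) where
  private
    S = transport φ (SquareOf.structure H)
  open Rim S

  halving⇒fanRoot : Halving rim → FanRoot (3 + n₃) H
  halving⇒fanRoot h = m₀ , M+M≡n , folding⇒≅PL H φ fan folding side side≢shared part-embed
    where
      open Halving h
      m₀ = half ∸ 2
      M≡half : 2 + m₀ ≡ half
      M≡half = m+[n∸m]≡n (half≥2 half half+half)
      M+M≡n : (2 + m₀) + (2 + m₀) ≡ 3 + n₃
      M+M≡n = trans (cong₂ _+_ M≡half M≡half) half+half
      open Fan m₀
      open FanFolding m₀ M+M≡n swap-reflects (SquareStructure.swap S) swap-hub swap-rim
      partAt : ℕ → Part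
      partAt l = SquareStructure.part S (F.suc (rotate l base))
      byVertex : ∀ {i} → FanVertex i →
                 SquareStructure.part S (embed i) ≡ (if labeled fan i then shared else side)
      byVertex hub = trans hub-shared (cong (if_then shared else side) (sym labeled-hub))
      byVertex (start j≡0) = trans (cong partAt j≡0)
        (trans part-base (cong (if_then shared else side) (sym (labeled-start j≡0))))
      byVertex (end j≡M) = trans (cong partAt (trans j≡M M≡half))
        (trans part-half (cong (if_then shared else side) (sym (labeled-end j≡M))))
      byVertex (inner {j} 0<j j<M) = trans (part-interior (toℕ j) 0<j (subst (toℕ j <_) M≡half j<M))
        (cong (if_then shared else side) (sym (labeled-inner 0<j j<M)))
      part-embed : ∀ i → SquareStructure.part S (embed i) ≡ (if labeled fan i then shared else side)
      part-embed i = byVertex (fanVertex i)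

  rootIsFan : FanRoot (3 + n₃) H
  rootIsFan = halving⇒fanRoot (CycleAnalysis.halving rim (proj₂ (CycleAnalysis.sharedVertex rim)))

m*2≡m+m : ∀ q → q * 2 ≡ q + q
m*2≡m+m q = trans (*-suc q 1) (cong (q +_) (*-identityʳ q))

+-double-injective : ∀ {x y} → x + x ≡ y + y → x ≡ y
+-double-injective {x} {y} e = *-cancelʳ-≡ x y 2 (trans (m*2≡m+m x) (trans e (sym (m*2≡m+m y))))

proposition4p5 : (n : ℕ) → 3 ≤ n →
    ((2 ∣ n) → IsSquare (wheel n))
  × ((¬ (2 ∣ n)) → ¬ IsSquare (wheel n))
  × (∀ {m₁ m₂} (H₁ : PLGraph m₁) (H₂ : PLGraph m₂) →
       square H₁ ≅ wheel n → square H₂ ≅ wheel n → H₁ ≅PL H₂)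
proposition4p5 (suc (suc (suc n₃))) (s≤s (s≤s (s≤s _))) = even , odd , unique
  where
    even : 2 ∣ 3 + n₃ → IsSquare (wheel (3 + n₃))
    even (divides (suc (suc m₀)) n≡q*2) =
      _ , Fan.fan m₀ , subst (λ n → square (Fan.fan m₀) ≅ wheel n) (sym (trans n≡q*2 (m*2≡m+m _)))
                             (fanSquare m₀)

    odd : ¬ 2 ∣ 3 + n₃ → ¬ IsSquare (wheel (3 + n₃))
    odd ¬2∣n (_ , H , φ) = ¬2∣n (even-order (rootIsFan H φ))
      where
        even-order : FanRoot (3 + n₃) H → 2 ∣ 3 + n₃
        even-order (m₀ , M+M≡n , _) = divides (Fan.M m₀) (trans (sym M+M≡n) (sym (m*2≡m+m (Fan.M m₀))))

    unique : ∀ {m₁ m₂} (H₁ : PLGraph m₁) (H₂ : PLGraph m₂) →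
             square H₁ ≅ wheel (3 + n₃) → square H₂ ≅ wheel (3 + n₃) → H₁ ≅PL H₂
    unique H₁ H₂ φ₁ φ₂ = same-fan (rootIsFan H₁ φ₁) (rootIsFan H₂ φ₂)
      where
        same-fan : FanRoot (3 + n₃) H₁ → FanRoot (3 + n₃) H₂ → H₁ ≅PL H₂
        same-fan (m₀ , e₁ , H₁≅fan) (m₀′ , e₂ , H₂≅fan)
          with +-double-injective {Fan.M m₀} {Fan.M m₀′} (trans e₁ (sym e₂))
        ... | refl = ≅PL-trans H₁≅fan (≅PL-sym H₂≅fan)
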